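{- Let $R=(V,\rho)$ be a binary relational structure. The following are equivalent: (i) the collection of robust modules of $R$, ordered by reverse inclusion, is well-founded (every nonempty set of robust modules contains one that is maximal for inclusion); (ii) every strong module of $R$ is robust.
   Context: A binary relational structure is a pair $R=(V,\rho)$ with $\rho\subseteq V\times V$. A module of $R$ is a set $A\subseteq V$ such that for all $a,a'\in A$ and $x\notin A$: $(x,a)\in\rho\iff(x,a')\in\rho$ and $(a,x)\in\rho\iff(a',x)\in\rho$. A strong module is a nonempty module $A$ such that every module is disjoint from $A$ or comparable with $A$ under inclusion. For nonempty $F\subseteq V$, $S(F)$ denotes the intersection of all strong modules containing $F$ (the least strong module containing $F$). A robust module is a set of the form $S(\{x,y\})$ for possibly equal $x,y\in V$. -}

module Defs where

open import Level using (0ℓ; suc)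
open import Data.Product using (_×_; ∃; ∃₂)
open import Data.Sum using (_⊎_)
open import Function.Bundles using (_⇔_)
open import Relation.Nullary using (¬_)
open import Relation.Binary.PropositionalEquality using (_≡_)
open import Relation.Binary.Core using (Rel)
open import Relation.Unary using (Pred; _⊆_; _≐_; _∈_; Empty; Satisfiable; _∩_)

record BinRelStr : Set₁ where
  field
    V : Set
    ρ : Rel V 0ℓ

Subset : Set → Set₁
Subset V = Pred V 0ℓ

module _ (R : BinRelStr) where
  open BinRelStr R

  IsModule : Subset V → Set
  IsModule A = ∀ a a' x → A a → A a' → ¬ A x →
    ((ρ x a ⇔ ρ x a') × (ρ a x ⇔ ρ a' x))

  IsStrongModule : Subset V → Set₁
  IsStrongModule A = Satisfiable A × IsModule A ×
    (∀ (B : Subset V) → IsModule B → Empty (B ∩ A) ⊎ (B ⊆ A ⊎ A ⊆ B))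

  S : Subset V → Pred V (suc 0ℓ)
  S F z = ∀ (B : Subset V) → IsStrongModule B → F ⊆ B → B z

  pair : V → V → Subset V
  pair x y z = z ≡ x ⊎ z ≡ y

  IsRobust : Subset V → Set₁
  IsRobust A = ∃₂ λ x y → A ≐ S (pair x y)

  RobustWellFounded : Set₂
  RobustWellFounded =
    ∀ (𝒞 : Pred (Subset V) (suc 0ℓ)) →
      (∀ A → 𝒞 A → IsRobust A) → Satisfiable 𝒞 →
      ∃ λ M → 𝒞 M × (∀ N → 𝒞 N → M ⊆ N → N ⊆ M)

  StrongAreRobust : Set₁
  StrongAreRobust = ∀ (A : Subset V) → IsStrongModule A → IsRobust A

{-# OPTIONS --safe #-}
-- Every robust module S({x,y}) is strong, and strong modules sharing a point
-- are nested.  (i) ⇒ (ii): for a strong module A, an inclusion-maximal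
-- S({x,y}) with x, y ∈ A swallows every z ∈ A, since it is comparable with
-- S({x,z}); and it lies inside A, so A = S({x,y}).  (ii) ⇒ (i): the members
-- of a set 𝒞 of robust modules that contain a fixed A₀ ∈ 𝒞 form a chain whose
-- union U is strong, hence U = S({u,v}) by (ii); a member M containing u and
-- v then contains U, so M is maximal.
module Submission where

open import Defs
open import Level using (Level; 0ℓ; suc)
open import Axiom.ExcludedMiddle using (ExcludedMiddle)
open import Axiom.DoubleNegationElimination using (em⇒dne)
open import Data.Product using (Σ; _×_; _,_; proj₁; proj₂; ∃; ∃₂)
open import Data.Empty using (⊥-elim)
open import Data.Sum using (_⊎_; inj₁; inj₂)
open import Relation.Nullary using (¬_; yes; no)
open import Relation.Nullary.Decidable using (True; toWitness; fromWitness)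
open import Relation.Unary using (Pred; _⊆_; _≐_; Empty; Satisfiable; _∩_; ⋃)
open import Relation.Binary.PropositionalEquality using (refl)

module _ (R : BinRelStr) where
  open BinRelStr R

  pair⊆ : ∀ {x y} {B : Subset V} → B x → B y → pair R x y ⊆ B
  pair⊆ Bx By (inj₁ refl) = Bx
  pair⊆ Bx By (inj₂ refl) = By

  F⊆S : ∀ {F : Subset V} → F ⊆ S R F
  F⊆S Fz B _ F⊆B = F⊆B Fz

  S-least : ∀ {F B : Subset V} → IsStrongModule R B → F ⊆ B → S R F ⊆ B
  S-least {B = B} sB F⊆B SFz = SFz B sB F⊆B

  comparable-with-strong : ∀ {B N : Subset V} {c} → IsModule R B → IsStrongModule R N →
    B c → N c → B ⊆ N ⊎ N ⊆ B
  comparable-with-strong {B} {c = c} modB (_ , _ , strongN) Bc Nc with strongN B modB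
  ... | inj₁ disjoint = ⊥-elim (disjoint c (Bc , Nc))
  ... | inj₂ comparable = comparable

  module-⊆-strong : ∀ {B C : Subset V} {c z} → IsModule R B → IsStrongModule R C →
    B c → C c → C z → ¬ B z → B ⊆ C
  module-⊆-strong modB sC Bc Cc Cz ¬Bz with comparable-with-strong modB sC Bc Cc
  ... | inj₁ B⊆C = B⊆C
  ... | inj₂ C⊆B = ⊥-elim (¬Bz (C⊆B Cz))

  Union : ∀ {ℓ} → Pred (Subset V) ℓ → Pred V _
  Union 𝒩 = ⋃ (Σ (Subset V) 𝒩) proj₁

  common-member : ∀ {ℓ} {𝒩 : Pred (Subset V) ℓ} {a x y} →
    (∀ {N} → 𝒩 N → IsStrongModule R N) → (∀ {N} → 𝒩 N → N a) →
    Union 𝒩 x → Union 𝒩 y → ∃ λ N → 𝒩 N × N x × N y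
  common-member strong ∋a ((N₁ , n₁) , N₁x) ((N₂ , n₂) , N₂y)
    with comparable-with-strong (proj₁ (proj₂ (strong n₁))) (strong n₂)
                                (∋a n₁) (∋a n₂)
  ... | inj₁ N₁⊆N₂ = N₂ , n₂ , N₁⊆N₂ N₁x , N₂y
  ... | inj₂ N₂⊆N₁ = N₁ , n₁ , N₁x , N₂⊆N₁ N₂y

  robust-Union-attained : ∀ {ℓ} {𝒩 : Pred (Subset V) ℓ} {a} {U : Subset V} →
    (∀ {N} → 𝒩 N → IsStrongModule R N) → (∀ {N} → 𝒩 N → N a) →
    IsRobust R U → U ≐ Union 𝒩 → ∃ λ M → 𝒩 M × U ⊆ M
  robust-Union-attained strong ∋a (u , v , U⊆S , S⊆U) (U⊆⋃ , _)
    with common-member strong ∋a (U⊆⋃ (S⊆U (F⊆S (inj₁ refl))))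
                                 (U⊆⋃ (S⊆U (F⊆S (inj₂ refl))))
  ... | M , M∈ , Mu , Mv = M , M∈ , λ Uz → S-least (strong M∈) (pair⊆ Mu Mv) (U⊆S Uz)

  RobustIn : Subset V → Pred (Subset V) (suc 0ℓ)
  RobustIn A N = ∃₂ λ x y → A x × A y × N ≐ S R (pair R x y)

  module _ (em : ∀ {ℓ : Level} → ExcludedMiddle ℓ) where

    ¬⊆⇒∃∖ : ∀ {a ℓ₁ ℓ₂} {A : Set a} {P : Pred A ℓ₁} {Q : Pred A ℓ₂} →
      ¬ (P ⊆ Q) → ∃ λ x → P x × ¬ Q x
    ¬⊆⇒∃∖ P⊈Q = dne λ ∄ → P⊈Q λ {x} Px → dne λ ¬Qx → ∄ (x , Px , ¬Qx)
      where
      dne : ∀ {ℓ} {P : Set ℓ} → ¬ ¬ P → P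
      dne = em⇒dne em

    -- S F and unions of families of subsets quantify over Subset V, so they are
    -- only Set₁-valued predicates; excluded middle gives equivalent Set-valued ones.
    resize : ∀ {ℓ} → Pred V ℓ → Subset V
    resize P z = True (em {P = P z})

    resize-≐ : ∀ {ℓ} {P : Pred V ℓ} → resize P ≐ P
    resize-≐ = toWitness , fromWitness

    mkStrongModule : ∀ {N : Subset V} → Satisfiable N → IsModule R N →
      (∀ B → IsModule R B → ∀ {c z} → B c → N c → N z → ¬ B z → B ⊆ N) →
      IsStrongModule R N
    mkStrongModule {N} nonempty modN absorb = nonempty , modN , compare
      where
      compare : ∀ B → IsModule R B → Empty (B ∩ N) ⊎ (B ⊆ N ⊎ N ⊆ B)
      compare B modB with em {P = Satisfiable (B ∩ N)} | em {P = N ⊆ B}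
      ... | no B∩N=∅ | _ = inj₁ λ z B∩Nz → B∩N=∅ (z , B∩Nz)
      ... | yes _ | yes N⊆B = inj₂ (inj₂ N⊆B)
      ... | yes (c , Bc , Nc) | no N⊈B with ¬⊆⇒∃∖ N⊈B
      ...   | z , Nz , ¬Bz = inj₂ (inj₁ (absorb B modB Bc Nc Nz ¬Bz))

    S-strong : ∀ {F N : Subset V} → Satisfiable F → N ≐ S R F → IsStrongModule R N
    S-strong {F} {N} (x , Fx) (N⊆S , S⊆N) = mkStrongModule (x , S⊆N (F⊆S Fx)) modN absorb
      where
      modN : IsModule R N
      modN a a' w Na Na' ¬Nw
        with ¬⊆⇒∃∖ {P = λ C → IsStrongModule R C × F ⊆ C} {Q = λ C → C w}
                   (λ Sw → ¬Nw (S⊆N λ C sC F⊆C → Sw (sC , F⊆C)))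
      ... | C , (sC , F⊆C) , ¬Cw =
        proj₁ (proj₂ sC) a a' w (N⊆S Na C sC F⊆C) (N⊆S Na' C sC F⊆C) ¬Cw
      absorb : ∀ B → IsModule R B → ∀ {c z} → B c → N c → N z → ¬ B z → B ⊆ N
      absorb B modB Bc Nc Nz ¬Bz Bb = S⊆N λ C sC F⊆C →
        let N⊆C : N ⊆ C
            N⊆C Ny = N⊆S Ny C sC F⊆C
        in module-⊆-strong modB sC Bc (N⊆C Nc) (N⊆C Nz) ¬Bz Bb

    robust⇒strong : ∀ {N : Subset V} → IsRobust R N → IsStrongModule R N
    robust⇒strong (x , y , N≐S) = S-strong (x , inj₁ refl) N≐S

    Union-strong : ∀ {ℓ} {𝒩 : Pred (Subset V) ℓ} {a} {U : Subset V} →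
      (∀ {N} → 𝒩 N → IsStrongModule R N) → (∀ {N} → 𝒩 N → N a) →
      Satisfiable 𝒩 → U ≐ Union 𝒩 → IsStrongModule R U
    Union-strong {a = a} {U} strong ∋a (N , n) (U⊆⋃ , ⋃⊆U) =
      mkStrongModule (a , ⋃⊆U ((N , n) , ∋a n)) modU absorb
      where
      modU : IsModule R U
      modU x x' w Ux Ux' ¬Uw with common-member strong ∋a (U⊆⋃ Ux) (U⊆⋃ Ux')
      ... | M , m , Mx , Mx' =
        proj₁ (proj₂ (strong m)) x x' w Mx Mx' λ Mw → ¬Uw (⋃⊆U ((M , m) , Mw))
      absorb : ∀ B → IsModule R B → ∀ {c z} → B c → U c → U z → ¬ B z → B ⊆ U
      absorb B modB Bc Uc Uz ¬Bz Bb with common-member strong ∋a (U⊆⋃ Uc) (U⊆⋃ Uz)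
      ... | M , m , Mc , Mz = ⋃⊆U ((M , m) , module-⊆-strong modB (strong m) Bc Mc Mz ¬Bz Bb)

    S₂ : V → V → Subset V
    S₂ x y = resize (S R (pair R x y))

    S₂-strong : ∀ {x y} → IsStrongModule R (S₂ x y)
    S₂-strong {x} {y} = robust⇒strong (x , y , resize-≐)

    S₂-∋ˡ : ∀ {x y} → S₂ x y x
    S₂-∋ˡ = fromWitness (F⊆S (inj₁ refl))

    S₂-∋ʳ : ∀ {x y} → S₂ x y y
    S₂-∋ʳ = fromWitness (F⊆S (inj₂ refl))

    maximal-RobustIn-⊇ : ∀ {A M : Subset V} → RobustIn A M →
      (∀ N → RobustIn A N → M ⊆ N → N ⊆ M) → A ⊆ M
    maximal-RobustIn-⊇ (x , _ , Ax , _ , M≐Sxy) maximal {z} Az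
      with comparable-with-strong (proj₁ (proj₂ S₂-strong))
                                  (S-strong (x , inj₁ refl) M≐Sxy)
             (S₂-∋ˡ {x} {z}) (proj₂ M≐Sxy (F⊆S (inj₁ refl)))
    ... | inj₁ Sxz⊆M = Sxz⊆M S₂-∋ʳ
    ... | inj₂ M⊆Sxz = maximal (S₂ x z) (x , z , Ax , Az , resize-≐) M⊆Sxz S₂-∋ʳ

    RobustWellFounded⇒StrongAreRobust : RobustWellFounded R → StrongAreRobust R
    RobustWellFounded⇒StrongAreRobust wf A sA@((a , Aa) , _)
      with wf (RobustIn A) (λ { N (x , y , _ , _ , N≐S) → x , y , N≐S })
              (S₂ a a , a , a , Aa , Aa , resize-≐)
    ... | M , M∈@(x , y , Ax , Ay , (M⊆S , _)) , maximal =
      x , y , (λ Az → M⊆S (maximal-RobustIn-⊇ M∈ maximal Az)) , S-least sA (pair⊆ Ax Ay)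

    StrongAreRobust⇒RobustWellFounded : StrongAreRobust R → RobustWellFounded R
    StrongAreRobust⇒RobustWellFounded strong⇒robust 𝒞 robust (A₀ , A₀∈) =
      let M , (M∈ , A₀⊆M) , U⊆M = robust-Union-attained strong ∋a₀ U-robust resize-≐
      in M , M∈ , λ N N∈ M⊆N Nz →
           U⊆M (⊆U {N} (N∈ , λ A₀y → M⊆N (A₀⊆M A₀y)) Nz)
      where
      𝒩 : Pred (Subset V) (suc 0ℓ)
      𝒩 N = 𝒞 N × A₀ ⊆ N
      strong : ∀ {N} → 𝒩 N → IsStrongModule R N
      strong (N∈ , _) = robust⇒strong (robust _ N∈)
      A₀-nonempty : Satisfiable A₀
      A₀-nonempty = proj₁ (robust⇒strong (robust A₀ A₀∈))
      ∋a₀ : ∀ {N} → 𝒩 N → N (proj₁ A₀-nonempty)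
      ∋a₀ (_ , A₀⊆N) = A₀⊆N (proj₂ A₀-nonempty)
      ⊆U : ∀ {N} → 𝒩 N → N ⊆ resize (Union 𝒩)
      ⊆U {N} N∈ Nz = fromWitness ((N , N∈) , Nz)
      U-robust : IsRobust R (resize (Union 𝒩))
      U-robust = strong⇒robust _
        (Union-strong strong ∋a₀ (A₀ , A₀∈ , λ A₀z → A₀z) resize-≐)

lemma6p2 : (∀ {ℓ : Level} → ExcludedMiddle ℓ) →
    (R : BinRelStr) →
    (RobustWellFounded R → StrongAreRobust R) × (StrongAreRobust R → RobustWellFounded R)
lemma6p2 em R = RobustWellFounded⇒StrongAreRobust R em , StrongAreRobust⇒RobustWellFounded R em
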